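{- Let $G$ be a finite simple graph with exactly two leaves $u$ and $v$, and suppose $G$ has a strongly antimagic labeling. Then for any integer $k\geqslant 1$, the graph obtained from $G$ by adding a new $u$–$v$ path of length $k$ (whose internal vertices are new) is strongly antimagic.
   Context: A leaf is a vertex of degree $1$. For a graph with $m$ edges, an antimagic labeling is a bijection $f:E\to\{1,\ldots,m\}$ such that the vertex sums $\phi_f(x)=\sum_{e\ni x}f(e)$ are pairwise distinct. A strongly antimagic labeling is an antimagic labeling with $\phi_f(x)>\phi_f(y)$ whenever $\deg(x)>\deg(y)$. A graph is strongly antimagic if it admits one. -}

module Defs where

open import Data.Nat using (ℕ; zero; suc; _+_; _<_; _>_)
open import Data.Fin using (Fin; zero; suc; inject₁; toℕ; _↑ˡ_; _↑ʳ_; splitAt)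
open import Data.Fin.Properties using (_≟_)
open import Data.Product using (Σ; _×_; _,_; proj₁; proj₂)
open import Data.Sum using (_⊎_; [_,_]′)
open import Data.Maybe using (Maybe; just; nothing; maybe′)
import Data.Maybe
open import Data.List using (List; filter; length; map; allFin)
open import Data.Nat.ListAction using (sum)
open import Relation.Binary.PropositionalEquality using (_≡_; _≢_)
open import Relation.Nullary.Decidable using (_⊎-dec_)
open import Function.Bundles using (_⤖_; Bijection)
open import Function using (_∘_)

record Graph : Set where
  constructor mkGraph
  field
    n    : ℕ
    m    : ℕ
    ends : Fin m → Fin n × Fin n
open Graph public

SameEnds : ∀ {n} → Fin n × Fin n → Fin n × Fin n → Set
SameEnds (a , b) (c , d) = (a ≡ c × b ≡ d) ⊎ (a ≡ d × b ≡ c)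

Simple : Graph → Set
Simple G = (∀ e → proj₁ (ends G e) ≢ proj₂ (ends G e))
         × (∀ e e′ → SameEnds (ends G e) (ends G e′) → e ≡ e′)

incident : (G : Graph) → Fin (n G) → List (Fin (m G))
incident G x = filter (λ e → (x ≟ proj₁ (ends G e)) ⊎-dec (x ≟ proj₂ (ends G e)))
                      (allFin (m G))

deg : (G : Graph) → Fin (n G) → ℕ
deg G x = length (incident G x)

Leaf : (G : Graph) → Fin (n G) → Set
Leaf G x = deg G x ≡ 1

-- A labeling is a bijection E → {1,…,m}; we encode the label of e as toℕ (f e) + 1.
Labeling : Graph → Set
Labeling G = Fin (m G) ⤖ Fin (m G)

label : (G : Graph) → Labeling G → Fin (m G) → ℕ
label G f e = suc (toℕ (Bijection.to f e))

φ : (G : Graph) → Labeling G → Fin (n G) → ℕ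
φ G f x = sum (map (label G f) (incident G x))

IsAntimagic : (G : Graph) → Labeling G → Set
IsAntimagic G f = ∀ x y → x ≢ y → φ G f x ≢ φ G f y

IsStronglyAntimagic : (G : Graph) → Labeling G → Set
IsStronglyAntimagic G f = IsAntimagic G f × (∀ x y → deg G x > deg G y → φ G f x > φ G f y)

StronglyAntimagic : Graph → Set
StronglyAntimagic G = Σ (Labeling G) (IsStronglyAntimagic G)

ExactlyTwoLeaves : (G : Graph) → Fin (n G) → Fin (n G) → Set
ExactlyTwoLeaves G u v = u ≢ v × Leaf G u × Leaf G v × (∀ x → Leaf G x → x ≡ u ⊎ x ≡ v)

step : ∀ j → Fin (suc j) → Maybe (Fin j)
step zero    zero    = nothing
step (suc j) zero    = just zero
step (suc j) (suc i) = Data.Maybe.map suc (step j i)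

-- Path vertices w₀ = u, w₁ … w_j new, w_{j+1} = v; new edge i joins w_i and w_{i+1}.
addPath : (G : Graph) → Fin (n G) → Fin (n G) → ℕ → Graph
addPath G u v j = mkGraph (n G + j) (m G + suc j) newEnds
  where
    w : Fin (suc (suc j)) → Fin (n G + j)
    w zero    = u ↑ˡ j
    w (suc i) = maybe′ (n G ↑ʳ_) (v ↑ˡ j) (step j i)
    oldE : Fin (m G) → Fin (n G + j) × Fin (n G + j)
    oldE e = (proj₁ (ends G e) ↑ˡ j) , (proj₂ (ends G e) ↑ˡ j)
    pathE : Fin (suc j) → Fin (n G + j) × Fin (n G + j)
    pathE i = w (inject₁ i) , w (suc i)
    newEnds : Fin (m G + suc j) → Fin (n G + j) × Fin (n G + j)
    newEnds = [ oldE , pathE ]′ ∘ splitAt (m G)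

module Submission where

-- Shift all labels of G up by k and label the k new path edges 1, …, k in the zigzag order
-- k, k − 2, k − 4, …, …, k − 3, k − 1, reversed if necessary so that the label k sits at the
-- endpoint with the larger vertex sum (this keeps the new sums at u and v apart). An old vertex
-- x ≠ u, v gains k · deg x, so old vertices keep their order. All path vertices have degree 2:
-- the internal ones have distinct sums below 2k, the ends u and v have sums at least 2k, and as
-- φ(u), φ(v) lie below the sum of every vertex of degree ≥ 2 of G, the ends stay below every
-- old vertex of degree ≥ 2.

open import Defs
open import Data.Empty using (⊥-elim)
open import Data.Fin
  using (Fin; zero; suc; toℕ; inject₁; fromℕ; fromℕ<; punchIn; punchOut; _↑ˡ_; _↑ʳ_; splitAt; join)
open import Data.Fin.Properties
  using ( _≟_; any?; injective⇒≤; punchInᵢ≢i; punchIn-injective; punchIn-punchOut; punchOut-injective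
        ; toℕ-injective; toℕ<n; toℕ≤pred[n]; toℕ-inject₁; toℕ-fromℕ; toℕ-fromℕ<; toℕ-↑ˡ; toℕ-↑ʳ
        ; ↑ˡ-injective; ↑ʳ-injective; splitAt-↑ˡ; splitAt-↑ʳ; join-splitAt
        ; inject₁-injective; fromℕ≢inject₁)
import Data.Fin.Properties as Fin
open import Data.Fin.Relation.Unary.Top using (view; ‵fromℕ; ‵inject₁)
open import Data.List using ([]; _∷_; map; filter; length; tabulate; allFin)
open import Data.List.Properties using (map-tabulate)
open import Data.Maybe using (just; nothing; maybe′)
open import Data.Nat using (ℕ; zero; suc; _+_; _*_; _∸_; _≤_; _<_; _>_; z≤n; z<s; s≤s; s≤s⁻¹; _<?_)
import Data.Nat.ListAction as ListAction
open import Data.Nat.Properties hiding (_≟_)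
open import Algebra.Properties.Semiring.Sum +-*-semiring
  using (sum; sum-cong-≗; ∑-distrib-+; *-distribˡ-sum; sum-remove; sum-replicate-zero)
open import Data.Nat.Tactic.RingSolver using (solve)
open import Data.Product using (_×_; _,_; proj₁; proj₂)
open import Data.Sum using (_⊎_; inj₁; inj₂)
import Data.Sum as Sum
open import Function using (_∘_)
open import Function.Bundles using (Bijection; mk⤖)
open import Function.Definitions using (Injective; Surjective)
open import Relation.Binary.Definitions using (tri<; tri≈; tri>)
open import Relation.Binary.PropositionalEquality
open import Relation.Nullary using (¬_; Dec; yes; no; contradiction)
open import Relation.Nullary.Decidable using (_⊎-dec_)
open import Relation.Unary using (Decidable)

-- Zigzag labellings of a path

-- The t-th edge of a path with j + 1 edges, counted from u, gets the label value t + 1; the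
-- adjacent sums are the contributions of the path edges to the internal path vertices.
record PathLabelling (j : ℕ) : Set where
  field
    value                  : ℕ → ℕ
    value-≤                : ∀ {t} → t ≤ j → value t ≤ j
    value-injective        : ∀ {s t} → s ≤ j → t ≤ j → value s ≡ value t → s ≡ t
    adjacent-sum-injective : ∀ {s t} → s < j → t < j →
                             value s + value (suc s) ≡ value t + value (suc t) → s ≡ t
    first-≥                : j ≤ suc (value 0)
    last-≥                 : j ≤ suc (value j)

reverse : ∀ {j} → PathLabelling j → PathLabelling j
reverse {j} P = record
  { value                  = λ t → value (j ∸ t)
  ; value-≤                = λ {t} _ → value-≤ (m∸n≤m j t)
  ; value-injective        = λ {s} {t} s≤j t≤j eq →
                               ∸-cancelˡ-≡ s≤j t≤j (value-injective (m∸n≤m j s) (m∸n≤m j t) eq)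
  ; adjacent-sum-injective = reversed-adjacent
  ; first-≥                = last-≥
  ; last-≥                 = subst (λ t → j ≤ suc (value t)) (sym (n∸n≡0 j)) first-≥
  }
  where
  open PathLabelling P
  j∸t≡1+[j∸1+t] : ∀ {t} → t < j → j ∸ t ≡ suc (j ∸ suc t)
  j∸t≡1+[j∸1+t] t<j = +-∸-assoc 1 t<j
  j∸1+t<j : ∀ {t} → t < j → j ∸ suc t < j
  j∸1+t<j {t} t<j = subst (_≤ j) (j∸t≡1+[j∸1+t] t<j) (m∸n≤m j t)
  reversed-adjacent : ∀ {s t} → s < j → t < j →
                      value (j ∸ s) + value (j ∸ suc s) ≡ value (j ∸ t) + value (j ∸ suc t) → s ≡ t
  reversed-adjacent {s} {t} s<j t<j eq = suc-injective (∸-cancelˡ-≡ s<j t<j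
    (adjacent-sum-injective (j∸1+t<j s<j) (j∸1+t<j t<j)
      (trans (sym (swap-adjacent s<j)) (trans eq (swap-adjacent t<j)))))
    where
    swap-adjacent : ∀ {r} → r < j →
                    value (j ∸ r) + value (j ∸ suc r) ≡ value (j ∸ suc r) + value (suc (j ∸ suc r))
    swap-adjacent {r} r<j =
      trans (cong (λ a → value a + value (j ∸ suc r)) (j∸t≡1+[j∸1+t] r<j)) (+-comm (value (suc (j ∸ suc r))) _)

-- zigzag k lists 0, …, k − 1 as k − 1, k − 3, …, then …, k − 4, k − 2.
zigzag : ℕ → ℕ → ℕ
zigzag k t with 2 * t <? k
... | yes _ = k ∸ suc (2 * t)
... | no  _ = 2 * t ∸ k

data ZigzagCase (k t q : ℕ) : Set where
  descending : 2 * t < k → q + suc (2 * t) ≡ k → ZigzagCase k t q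
  ascending  : k ≤ 2 * t → q + k ≡ 2 * t → ZigzagCase k t q

zigzag-case : ∀ k t → ZigzagCase k t (zigzag k t)
zigzag-case k t with 2 * t <? k
... | yes 2t<k = descending 2t<k (m∸n+n≡m 2t<k)
... | no  2t≮k = ascending (≮⇒≥ 2t≮k) (m∸n+n≡m (≮⇒≥ 2t≮k))

zigzag-< : ∀ {k t} → t < k → zigzag k t < k
zigzag-< {k} {t} t<k with zigzag-case k t
... | descending _ q+1+2t≡k = subst (zigzag k t <_) q+1+2t≡k (m<m+n _ z<s)
... | ascending  _ q+k≡2t   = +-cancelʳ-< k _ k (begin-strict
  zigzag k t + k ≡⟨ q+k≡2t ⟩
  2 * t          <⟨ *-monoʳ-< 2 t<k ⟩
  2 * k          ≡⟨ solve (k ∷ []) ⟩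
  k + k          ∎)
  where open ≤-Reasoning

zigzag-injective : ∀ k {s t} → zigzag k s ≡ zigzag k t → s ≡ t
zigzag-injective k {s} {t} eq with zigzag k s | zigzag-case k s | zigzag k t | zigzag-case k t
... | q | descending _ e₁ | _ | descending _ e₂ with refl ← eq =
  *-cancelˡ-≡ s t 2 (suc-injective (+-cancelˡ-≡ q _ _ (trans e₁ (sym e₂))))
... | q | ascending _ e₁  | _ | ascending _ e₂  with refl ← eq = *-cancelˡ-≡ s t 2 (trans (sym e₁) e₂)
... | q | descending _ e₁ | _ | ascending _ e₂  with refl ← eq = ⊥-elim (even≢odd t (q + s) (begin
  2 * t                    ≡⟨ e₂ ⟨
  q + k                    ≡⟨ cong (q +_) e₁ ⟨
  q + (q + suc (2 * s))    ≡⟨ solve (q ∷ s ∷ []) ⟩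
  suc (2 * (q + s))        ∎))
  where open ≡-Reasoning
... | q | ascending _ e₁  | _ | descending _ e₂ with refl ← eq = ⊥-elim (even≢odd s (q + t) (begin
  2 * s                    ≡⟨ e₁ ⟨
  q + k                    ≡⟨ cong (q +_) e₂ ⟨
  q + (q + suc (2 * t))    ≡⟨ solve (q ∷ t ∷ []) ⟩
  suc (2 * (q + t))        ∎))
  where open ≡-Reasoning

zigzag-last : ∀ j → j ≤ suc (zigzag (suc j) j)
zigzag-last j with zigzag (suc j) j | zigzag-case (suc j) j
... | _ | descending 2j<1+j _ = ≤-trans (+-cancelˡ-≤ j j 0 (begin
  j + j ≡⟨ solve (j ∷ []) ⟩
  2 * j ≤⟨ s≤s⁻¹ 2j<1+j ⟩
  j     ≡⟨ +-identityʳ j ⟨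
  j + 0 ∎)) z≤n
  where open ≤-Reasoning
... | q | ascending _ q+1+j≡2j = ≤-reflexive (+-cancelʳ-≡ j j (suc q) (begin
  j + j       ≡⟨ solve (j ∷ []) ⟩
  2 * j       ≡⟨ q+1+j≡2j ⟨
  q + suc j   ≡⟨ +-suc q j ⟩
  suc q + j   ∎))
  where open ≡-Reasoning

-- Adjacent sums within the descending run, at the turn, and within the ascending run are
-- ≡ 2k (mod 4), = 1, and ≡ 2 − 2k (mod 4), respectively.
data AdjacentSumCase (k t s : ℕ) : Set where
  both-descending : s + 4 * suc t ≡ 2 * k → AdjacentSumCase k t s
  turning         : s ≡ 1 → 2 * t < k → k ≤ 2 * suc t → AdjacentSumCase k t s
  both-ascending  : s + 2 * k ≡ 2 * suc (2 * t) → AdjacentSumCase k t s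

zigzag-adjacent-sum-case : ∀ k t → AdjacentSumCase k t (zigzag k t + zigzag k (suc t))
zigzag-adjacent-sum-case k t with zigzag k t | zigzag-case k t | zigzag k (suc t) | zigzag-case k (suc t)
... | a | descending _ e₁ | b | descending _ e₂ = both-descending (begin
  a + b + 4 * suc t                              ≡⟨ solve (a ∷ b ∷ t ∷ []) ⟩
  (a + suc (2 * t)) + (b + suc (2 * suc t))      ≡⟨ cong₂ _+_ e₁ e₂ ⟩
  k + k                                          ≡⟨ solve (k ∷ []) ⟩
  2 * k                                          ∎)
  where open ≡-Reasoning
... | a | descending 2t<k e₁ | b | ascending k≤2+2t e₂ = turning (+-cancelʳ-≡ (suc (2 * t) + k) (a + b) 1 (begin
  a + b + (suc (2 * t) + k)                      ≡⟨ solve (a ∷ b ∷ t ∷ k ∷ []) ⟩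
  (a + suc (2 * t)) + (b + k)                    ≡⟨ cong₂ _+_ e₁ e₂ ⟩
  k + 2 * suc t                                  ≡⟨ solve (k ∷ t ∷ []) ⟩
  1 + (suc (2 * t) + k)                          ∎)) 2t<k k≤2+2t
  where open ≡-Reasoning
... | _ | ascending k≤2t _ | _ | descending 2+2t<k _ =
  contradiction (≤-trans k≤2t (*-monoʳ-≤ 2 (n≤1+n t))) (<⇒≱ 2+2t<k)
... | a | ascending _ e₁ | b | ascending _ e₂ = both-ascending (begin
  a + b + 2 * k                                  ≡⟨ solve (a ∷ b ∷ k ∷ []) ⟩
  (a + k) + (b + k)                              ≡⟨ cong₂ _+_ e₁ e₂ ⟩
  2 * t + 2 * suc t                              ≡⟨ solve (t ∷ []) ⟩
  2 * suc (2 * t)                                ∎)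
  where open ≡-Reasoning

turning-unique : ∀ {k t r} → 2 * t < k → k ≤ 2 * suc t → 2 * r < k → k ≤ 2 * suc r → t ≡ r
turning-unique {t = t} {r} 2t<k k≤2+2t 2r<k k≤2+2r with <-cmp t r
... | tri< t<r _ _ = contradiction (≤-trans k≤2+2t (*-monoʳ-≤ 2 t<r)) (<⇒≱ 2r<k)
... | tri≈ _ t≡r _ = t≡r
... | tri> _ _ r<t = contradiction (≤-trans k≤2+2r (*-monoʳ-≤ 2 r<t)) (<⇒≱ 2t<k)

descending≢turning : ∀ k t → 1 + 4 * suc t ≢ 2 * k
descending≢turning k t eq = even≢odd k (2 * suc t) (trans (sym eq) (solve (t ∷ [])))

ascending≢turning : ∀ k t → 1 + 2 * k ≢ 2 * suc (2 * t)
ascending≢turning k t eq = even≢odd (suc (2 * t)) k (sym eq)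

descending≢ascending : ∀ k t r s → s + 4 * suc t ≡ 2 * k → s + 2 * k ≢ 2 * suc (2 * r)
descending≢ascending k t r s e₁ e₂ = even≢odd k (suc (r + t)) (*-cancelˡ-≡ _ _ 2 (begin
  2 * (2 * k)                ≡⟨ solve (k ∷ []) ⟩
  2 * k + 2 * k              ≡⟨ cong (_+ 2 * k) e₁ ⟨
  s + 4 * suc t + 2 * k      ≡⟨ solve (s ∷ t ∷ k ∷ []) ⟩
  (s + 2 * k) + 4 * suc t    ≡⟨ cong (_+ 4 * suc t) e₂ ⟩
  2 * suc (2 * r) + 4 * suc t  ≡⟨ solve (r ∷ t ∷ []) ⟩
  2 * suc (2 * suc (r + t))  ∎))
  where open ≡-Reasoning

zigzag-adjacent-sum-injective : ∀ k {t r} → zigzag k t + zigzag k (suc t) ≡ zigzag k r + zigzag k (suc r) → t ≡ r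
zigzag-adjacent-sum-injective k {t} {r} eq
  with zigzag k t + zigzag k (suc t) | zigzag-adjacent-sum-case k t
     | zigzag k r + zigzag k (suc r) | zigzag-adjacent-sum-case k r
... | s | both-descending e₁ | _ | both-descending e₂ with refl ← eq =
  suc-injective (*-cancelˡ-≡ _ _ 4 (+-cancelˡ-≡ s _ _ (trans e₁ (sym e₂))))
... | s | both-ascending e₁ | _ | both-ascending e₂ with refl ← eq =
  *-cancelˡ-≡ t r 2 (suc-injective (*-cancelˡ-≡ _ _ 2 (trans (sym e₁) e₂)))
... | _ | turning _ 2t<k k≤2+2t | _ | turning _ 2r<k k≤2+2r = turning-unique 2t<k k≤2+2t 2r<k k≤2+2r
... | _ | both-descending e₁ | _ | turning refl _ _ with refl ← eq = ⊥-elim (descending≢turning k t e₁)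
... | _ | turning refl _ _ | _ | both-descending e₂ with refl ← eq = ⊥-elim (descending≢turning k r e₂)
... | _ | both-ascending e₁ | _ | turning refl _ _ with refl ← eq = ⊥-elim (ascending≢turning k t e₁)
... | _ | turning refl _ _ | _ | both-ascending e₂ with refl ← eq = ⊥-elim (ascending≢turning k r e₂)
... | s | both-descending e₁ | _ | both-ascending e₂ with refl ← eq =
  ⊥-elim (descending≢ascending k t r s e₁ e₂)
... | s | both-ascending e₁ | _ | both-descending e₂ with refl ← eq =
  ⊥-elim (descending≢ascending k r t s e₂ e₁)

zigzagLabelling : ∀ j → PathLabelling j
zigzagLabelling j = record
  { value                  = zigzag (suc j)
  ; value-≤                = λ t≤j → s≤s⁻¹ (zigzag-< (s≤s t≤j))
  ; value-injective        = λ _ _ → zigzag-injective (suc j)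
  ; adjacent-sum-injective = λ _ _ → zigzag-adjacent-sum-injective (suc j)
  ; first-≥                = n≤1+n j
  ; last-≥                 = zigzag-last j
  }

-- Vertex sums as sums over edges

sum-splitAt : ∀ a {b} (g : Fin (a + b) → ℕ) → sum g ≡ sum (g ∘ (_↑ˡ b)) + sum (g ∘ (a ↑ʳ_))
sum-splitAt zero    g = refl
sum-splitAt (suc a) g = trans (cong (g zero +_) (sum-splitAt a (g ∘ suc))) (sym (+-assoc (g zero) _ _))

sum-zero : ∀ {n} {g : Fin n → ℕ} → (∀ i → g i ≡ 0) → sum g ≡ 0
sum-zero {n} g≗0 = trans (sum-cong-≗ g≗0) (sum-replicate-zero n)

sum-single : ∀ {n} {g : Fin (suc n) → ℕ} a → (∀ i → i ≢ a → g i ≡ 0) → sum g ≡ g a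
sum-single {g = g} a g-zero = begin
  sum g                        ≡⟨ sum-remove g ⟩
  g a + sum (g ∘ punchIn a)    ≡⟨ cong (g a +_) (sum-zero (λ i → g-zero (punchIn a i) (punchInᵢ≢i a i))) ⟩
  g a + 0                      ≡⟨ +-identityʳ (g a) ⟩
  g a                          ∎
  where open ≡-Reasoning

sum-pair : ∀ {n} {g : Fin (suc n) → ℕ} {a b} → a ≢ b → (∀ i → i ≢ a → i ≢ b → g i ≡ 0) →
           sum g ≡ g a + g b
sum-pair {zero}  {a = zero} {zero} a≢b _ = contradiction refl a≢b
sum-pair {suc _} {g = g} {a} {b} a≢b g-zero = begin
  sum g                              ≡⟨ sum-remove g ⟩
  g a + sum (g ∘ punchIn a)          ≡⟨ cong (g a +_) (sum-single (punchOut a≢b) removed-zero) ⟩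
  g a + g (punchIn a (punchOut a≢b)) ≡⟨ cong (λ c → g a + g c) (punchIn-punchOut a≢b) ⟩
  g a + g b                          ∎
  where
  open ≡-Reasoning
  removed-zero : ∀ i → i ≢ punchOut a≢b → g (punchIn a i) ≡ 0
  removed-zero i i≢ = g-zero (punchIn a i) (punchInᵢ≢i a i)
    (λ eq → i≢ (punchIn-injective a i _ (trans eq (sym (punchIn-punchOut a≢b)))))

indicator : ∀ {p} {P : Set p} → Dec P → ℕ → ℕ
indicator (yes _) a = a
indicator (no _)  _ = 0

indicator-yes : ∀ {p} {P : Set p} (P? : Dec P) {a} → P → indicator P? a ≡ a
indicator-yes (yes _) _ = refl
indicator-yes (no ¬p) p = contradiction p ¬p

indicator-no : ∀ {p} {P : Set p} (P? : Dec P) {a} → ¬ P → indicator P? a ≡ 0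
indicator-no (yes p) ¬p = contradiction p ¬p
indicator-no (no _)  _  = refl

indicator-cong : ∀ {p q} {P : Set p} {Q : Set q} (P? : Dec P) (Q? : Dec Q) {a} →
                 (P → Q) → (Q → P) → indicator P? a ≡ indicator Q? a
indicator-cong (yes p) Q? to _    = sym (indicator-yes Q? (to p))
indicator-cong (no ¬p) Q? _  from = sym (indicator-no Q? (¬p ∘ from))

indicator-shift : ∀ {p} {P : Set p} (P? : Dec P) c a → indicator P? (c + a) ≡ indicator P? a + c * indicator P? 1
indicator-shift (yes _) c a = trans (+-comm c a) (cong (a +_) (sym (*-identityʳ c)))
indicator-shift (no _)  c a = sym (*-zeroʳ c)

sum-map-filter : ∀ {a p} {A : Set a} {P : A → Set p} (P? : Decidable P) (h : A → ℕ) xs →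
                 ListAction.sum (map h (filter P? xs)) ≡ ListAction.sum (map (λ x → indicator (P? x) (h x)) xs)
sum-map-filter P? h []       = refl
sum-map-filter P? h (x ∷ xs) with P? x
... | yes _ = cong (h x +_) (sum-map-filter P? h xs)
... | no  _ = sum-map-filter P? h xs

length-filter : ∀ {a p} {A : Set a} {P : A → Set p} (P? : Decidable P) xs →
                length (filter P? xs) ≡ ListAction.sum (map (λ x → indicator (P? x) 1) xs)
length-filter P? []       = refl
length-filter P? (x ∷ xs) with P? x
... | yes _ = cong suc (length-filter P? xs)
... | no  _ = length-filter P? xs

sum-tabulate : ∀ {n} (g : Fin n → ℕ) → ListAction.sum (tabulate g) ≡ sum g
sum-tabulate {zero}  g = refl
sum-tabulate {suc n} g = cong (g zero +_) (sum-tabulate (g ∘ suc))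

sum-map-allFin : ∀ {n} (g : Fin n → ℕ) → ListAction.sum (map g (allFin n)) ≡ sum g
sum-map-allFin g = trans (cong ListAction.sum (map-tabulate (λ i → i) g)) (sum-tabulate g)

Endpoint : ∀ {n} → Fin n → Fin n × Fin n → Set
Endpoint x ends = x ≡ proj₁ ends ⊎ x ≡ proj₂ ends

incident? : (G : Graph) (x : Fin (n G)) (e : Fin (m G)) → Dec (Endpoint x (ends G e))
incident? G x e = (x ≟ proj₁ (ends G e)) ⊎-dec (x ≟ proj₂ (ends G e))

incidenceSum : (G : Graph) → (Fin (m G) → ℕ) → Fin (n G) → ℕ
incidenceSum G h x = sum λ e → indicator (incident? G x e) (h e)

deg≡incidenceSum : ∀ G x → deg G x ≡ incidenceSum G (λ _ → 1) x
deg≡incidenceSum G x =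
  trans (length-filter (incident? G x) (allFin (m G))) (sum-map-allFin (λ e → indicator (incident? G x e) 1))

φ≡incidenceSum : ∀ G f x → φ G f x ≡ incidenceSum G (label G f) x
φ≡incidenceSum G f x = trans (sum-map-filter (incident? G x) (label G f) (allFin (m G)))
                             (sum-map-allFin (λ e → indicator (incident? G x e) (label G f e)))

incidenceSum-shift : ∀ G h c x →
                     incidenceSum G (λ e → c + h e) x ≡ incidenceSum G h x + c * incidenceSum G (λ _ → 1) x
incidenceSum-shift G h c x = begin
  sum (λ e → indicator (incident? G x e) (c + h e))
    ≡⟨ sum-cong-≗ (λ e → indicator-shift (incident? G x e) c (h e)) ⟩
  sum (λ e → indicator (incident? G x e) (h e) + c * indicator (incident? G x e) 1)
    ≡⟨ ∑-distrib-+ (λ e → indicator (incident? G x e) (h e)) (λ e → c * indicator (incident? G x e) 1) ⟩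
  incidenceSum G h x + sum (λ e → c * indicator (incident? G x e) 1)
    ≡⟨ cong (incidenceSum G h x +_) (sym (*-distribˡ-sum c (λ e → indicator (incident? G x e) 1))) ⟩
  incidenceSum G h x + c * incidenceSum G (λ _ → 1) x ∎
  where open ≡-Reasoning

deg≤φ : ∀ G f x → deg G x ≤ φ G f x
deg≤φ G f x = length≤sum (incident G x)
  where
  length≤sum : ∀ es → length es ≤ ListAction.sum (map (label G f) es)
  length≤sum []       = z≤n
  length≤sum (e ∷ es) = s≤s (≤-trans (length≤sum es) (m≤n+m _ _))

φ-isolated : ∀ G f x → deg G x ≡ 0 → φ G f x ≡ 0
φ-isolated G f x with incident G x
... | [] = λ _ → refl

-- The graph with an added path

↑ˡ≢↑ʳ : ∀ {m n} (x : Fin m) (t : Fin n) → x ↑ˡ n ≢ m ↑ʳ t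
↑ˡ≢↑ʳ {m} {n} x t eq = <-irrefl (begin
  toℕ x          ≡⟨ toℕ-↑ˡ x n ⟨
  toℕ (x ↑ˡ n)   ≡⟨ cong toℕ eq ⟩
  toℕ (m ↑ʳ t)   ≡⟨ toℕ-↑ʳ m t ⟩
  m + toℕ t      ∎) (<-≤-trans (toℕ<n x) (m≤m+n m (toℕ t)))
  where open ≡-Reasoning

injective⇒surjective : ∀ {n} {g : Fin n → Fin n} → Injective _≡_ _≡_ g → Surjective _≡_ _≡_ g
injective⇒surjective {zero}              _     ()
injective⇒surjective {suc n} {g} g-injective y with any? (λ x → g x ≟ y)
... | yes (x , gx≡y) = x , λ { refl → gx≡y }
... | no  ∄x         = contradiction (injective⇒≤ punched-injective) 1+n≰n
  where
  gx≢y : ∀ x → y ≢ g x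
  gx≢y x eq = ∄x (x , sym eq)
  punched : Fin (suc n) → Fin n
  punched x = punchOut (gx≢y x)
  punched-injective : Injective _≡_ _≡_ punched
  punched-injective eq = g-injective (punchOut-injective (gx≢y _) (gx≢y _) eq)

step-inject₁ : ∀ j (t : Fin j) → step j (inject₁ t) ≡ just t
step-inject₁ (suc j) zero    = refl
step-inject₁ (suc j) (suc t) rewrite step-inject₁ j t = refl

step-fromℕ : ∀ j → step j (fromℕ j) ≡ nothing
step-fromℕ zero    = refl
step-fromℕ (suc j) rewrite step-fromℕ j = refl

module PathExtension (G : Graph) {u v : Fin (n G)} (u≢v : u ≢ v) (j : ℕ) where

  H : Graph
  H = addPath G u v j

  pathVertex : Fin (suc (suc j)) → Fin (n G + j)
  pathVertex zero    = u ↑ˡ j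
  pathVertex (suc i) = maybe′ (n G ↑ʳ_) (v ↑ˡ j) (step j i)

  pathVertex-middle : ∀ t → pathVertex (suc (inject₁ t)) ≡ n G ↑ʳ t
  pathVertex-middle t rewrite step-inject₁ j t = refl

  pathVertex-last : pathVertex (suc (fromℕ j)) ≡ v ↑ˡ j
  pathVertex-last rewrite step-fromℕ j = refl

  ends-↑ˡ : ∀ e → ends H (e ↑ˡ suc j) ≡ (proj₁ (ends G e) ↑ˡ j , proj₂ (ends G e) ↑ˡ j)
  ends-↑ˡ e rewrite splitAt-↑ˡ (m G) e (suc j) = refl

  ends-↑ʳ : ∀ i → ends H (m G ↑ʳ i) ≡ (pathVertex (inject₁ i) , pathVertex (suc i))
  ends-↑ʳ i rewrite splitAt-↑ʳ (m G) (suc j) i with i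
  ... | zero  = refl
  ... | suc _ = refl

  data Position : Fin (suc (suc j)) → Set where
    first  : Position zero
    middle : ∀ t → Position (suc (inject₁ t))
    last   : Position (suc (fromℕ j))

  position : ∀ y → Position y
  position zero = first
  position (suc i) with view i
  ... | ‵fromℕ     = last
  ... | ‵inject₁ t = middle t

  pathVertex-injective : ∀ {y y′} → pathVertex y ≡ pathVertex y′ → y ≡ y′
  pathVertex-injective {y} {y′} eq with position y | position y′
  ... | first    | first     = refl
  ... | first    | middle t′ = ⊥-elim (↑ˡ≢↑ʳ u t′ (trans eq (pathVertex-middle t′)))
  ... | first    | last      = ⊥-elim (u≢v (↑ˡ-injective j u v (trans eq pathVertex-last)))
  ... | middle t | first     = ⊥-elim (↑ˡ≢↑ʳ u t (trans (sym eq) (pathVertex-middle t)))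
  ... | middle t | middle t′ = cong (suc ∘ inject₁)
    (↑ʳ-injective (n G) t t′ (trans (sym (pathVertex-middle t)) (trans eq (pathVertex-middle t′))))
  ... | middle t | last      =
    ⊥-elim (↑ˡ≢↑ʳ v t (trans (sym pathVertex-last) (trans (sym eq) (pathVertex-middle t))))
  ... | last     | first     = ⊥-elim (u≢v (↑ˡ-injective j u v (trans (sym eq) pathVertex-last)))
  ... | last     | middle t′ =
    ⊥-elim (↑ˡ≢↑ʳ v t′ (trans (sym pathVertex-last) (trans eq (pathVertex-middle t′))))
  ... | last     | last      = refl

  ↑ˡ≢pathVertex : ∀ {x} → x ≢ u → x ≢ v → ∀ y → x ↑ˡ j ≢ pathVertex y
  ↑ˡ≢pathVertex {x} x≢u x≢v y eq with position y
  ... | first    = x≢u (↑ˡ-injective j x u eq)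
  ... | middle t = ↑ˡ≢↑ʳ x t (trans eq (pathVertex-middle t))
  ... | last     = x≢v (↑ˡ-injective j x v (trans eq pathVertex-last))

  OnEdge : Fin (suc (suc j)) → Fin (suc j) → Set
  OnEdge y i = y ≡ inject₁ i ⊎ y ≡ suc i

  pathSum : Fin (n G + j) → (Fin (suc j) → ℕ) → ℕ
  pathSum z g = sum λ i → indicator (incident? H z (m G ↑ʳ i)) (g i)

  oldSum : Fin (n G + j) → (Fin (m G) → ℕ) → ℕ
  oldSum z g = sum λ e → indicator (incident? H z (e ↑ˡ suc j)) (g e)

  incidenceSum-split : ∀ h z → incidenceSum H h z ≡ oldSum z (h ∘ (_↑ˡ suc j)) + pathSum z (h ∘ (m G ↑ʳ_))
  incidenceSum-split h z = sum-splitAt (m G) (λ e → indicator (incident? H z e) (h e))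

  oldSum-↑ˡ : ∀ x g → oldSum (x ↑ˡ j) g ≡ incidenceSum G g x
  oldSum-↑ˡ x g = sum-cong-≗ λ e → indicator-cong (incident? H (x ↑ˡ j) (e ↑ˡ suc j)) (incident? G x e)
    (lower e) (lift e)
    where
    lower : ∀ e → Endpoint (x ↑ˡ j) (ends H (e ↑ˡ suc j)) → Endpoint x (ends G e)
    lower e rewrite ends-↑ˡ e = Sum.map (↑ˡ-injective j _ _) (↑ˡ-injective j _ _)
    lift : ∀ e → Endpoint x (ends G e) → Endpoint (x ↑ˡ j) (ends H (e ↑ˡ suc j))
    lift e rewrite ends-↑ˡ e = Sum.map (cong (_↑ˡ j)) (cong (_↑ˡ j))

  oldSum-↑ʳ : ∀ t g → oldSum (n G ↑ʳ t) g ≡ 0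
  oldSum-↑ʳ t g = sum-zero λ e → indicator-no (incident? H (n G ↑ʳ t) (e ↑ˡ suc j)) (not-old e)
    where
    not-old : ∀ e → ¬ Endpoint (n G ↑ʳ t) (ends H (e ↑ˡ suc j))
    not-old e rewrite ends-↑ˡ e = Sum.[ ↑ˡ≢↑ʳ _ t ∘ sym , ↑ˡ≢↑ʳ _ t ∘ sym ]

  indicator-onEdge : ∀ {y i} a → OnEdge y i → indicator (incident? H (pathVertex y) (m G ↑ʳ i)) a ≡ a
  indicator-onEdge {y} {i} a on = indicator-yes (incident? H (pathVertex y) (m G ↑ʳ i)) (endpoint on)
    where
    endpoint : OnEdge y i → Endpoint (pathVertex y) (ends H (m G ↑ʳ i))
    endpoint rewrite ends-↑ʳ i = Sum.map (cong pathVertex) (cong pathVertex)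

  indicator-offPath : ∀ {z i} a → (∀ y → z ≡ pathVertex y → ¬ OnEdge y i) →
                      indicator (incident? H z (m G ↑ʳ i)) a ≡ 0
  indicator-offPath {z} {i} a off = indicator-no (incident? H z (m G ↑ʳ i)) not-endpoint
    where
    not-endpoint : ¬ Endpoint z (ends H (m G ↑ʳ i))
    not-endpoint rewrite ends-↑ʳ i = Sum.[ (λ p → off _ p (inj₁ refl)) , (λ p → off _ p (inj₂ refl)) ]

  indicator-offEdge : ∀ {y i} a → ¬ OnEdge y i → indicator (incident? H (pathVertex y) (m G ↑ʳ i)) a ≡ 0
  indicator-offEdge {i = i} a ¬on =
    indicator-offPath a λ y′ eq → ¬on ∘ subst (λ w → OnEdge w i) (sym (pathVertex-injective eq))

  onEdge-first : ∀ {i} → OnEdge zero i → i ≡ zero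
  onEdge-first (inj₁ p) = inject₁-injective (sym p)

  onEdge-last : ∀ {i} → OnEdge (suc (fromℕ j)) i → i ≡ fromℕ j
  onEdge-last (inj₁ p) = ⊥-elim (fromℕ≢inject₁ p)
  onEdge-last (inj₂ p) = sym (Fin.suc-injective p)

  onEdge-middle : ∀ {t i} → OnEdge (suc (inject₁ t)) i → i ≡ inject₁ t ⊎ i ≡ suc t
  onEdge-middle (inj₁ p) = inj₂ (sym (inject₁-injective p))
  onEdge-middle (inj₂ p) = inj₁ (sym (Fin.suc-injective p))

  pathSum-old : ∀ {x} → x ≢ u → x ≢ v → ∀ g → pathSum (x ↑ˡ j) g ≡ 0
  pathSum-old x≢u x≢v g =
    sum-zero λ i → indicator-offPath {i = i} (g i) λ y eq _ → ↑ˡ≢pathVertex x≢u x≢v y eq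

  pathSum-first : ∀ g → pathSum (pathVertex zero) g ≡ g zero
  pathSum-first g = trans (sum-single zero λ i i≢0 → indicator-offEdge (g i) (i≢0 ∘ onEdge-first))
                          (indicator-onEdge (g zero) (inj₁ refl))

  pathSum-last : ∀ g → pathSum (pathVertex (suc (fromℕ j))) g ≡ g (fromℕ j)
  pathSum-last g = trans (sum-single (fromℕ j) λ i i≢j → indicator-offEdge (g i) (i≢j ∘ onEdge-last))
                         (indicator-onEdge (g (fromℕ j)) (inj₂ refl))

  pathSum-middle : ∀ t g → pathSum (pathVertex (suc (inject₁ t))) g ≡ g (inject₁ t) + g (suc t)
  pathSum-middle t g = trans
    (sum-pair inject₁≢suc λ i i≢t i≢1+t → indicator-offEdge (g i) (Sum.[ i≢t , i≢1+t ] ∘ onEdge-middle))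
    (cong₂ _+_ (indicator-onEdge (g (inject₁ t)) (inj₂ refl)) (indicator-onEdge (g (suc t)) (inj₁ refl)))
    where
    inject₁≢suc : inject₁ t ≢ suc t
    inject₁≢suc eq = <-irrefl (trans (sym (toℕ-inject₁ t)) (cong toℕ eq)) ≤-refl

  incidenceSum-old : ∀ h {x} → x ≢ u → x ≢ v →
                     incidenceSum H h (x ↑ˡ j) ≡ incidenceSum G (h ∘ (_↑ˡ suc j)) x
  incidenceSum-old h {x} x≢u x≢v = begin
    incidenceSum H h (x ↑ˡ j)
      ≡⟨ incidenceSum-split h (x ↑ˡ j) ⟩
    oldSum (x ↑ˡ j) (h ∘ (_↑ˡ suc j)) + pathSum (x ↑ˡ j) (h ∘ (m G ↑ʳ_))
      ≡⟨ cong₂ _+_ (oldSum-↑ˡ x _) (pathSum-old x≢u x≢v (h ∘ (m G ↑ʳ_))) ⟩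
    incidenceSum G (h ∘ (_↑ˡ suc j)) x + 0
      ≡⟨ +-identityʳ _ ⟩
    incidenceSum G (h ∘ (_↑ˡ suc j)) x
      ∎
    where open ≡-Reasoning

  incidenceSum-u : ∀ h → incidenceSum H h (u ↑ˡ j) ≡ incidenceSum G (h ∘ (_↑ˡ suc j)) u + h (m G ↑ʳ zero)
  incidenceSum-u h =
    trans (incidenceSum-split h (u ↑ˡ j)) (cong₂ _+_ (oldSum-↑ˡ u _) (pathSum-first (h ∘ (m G ↑ʳ_))))

  incidenceSum-v : ∀ h →
                   incidenceSum H h (v ↑ˡ j) ≡ incidenceSum G (h ∘ (_↑ˡ suc j)) v + h (m G ↑ʳ fromℕ j)
  incidenceSum-v h = trans (incidenceSum-split h (v ↑ˡ j)) (cong₂ _+_ (oldSum-↑ˡ v _)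
    (trans (cong (λ z → pathSum z (h ∘ (m G ↑ʳ_))) (sym pathVertex-last)) (pathSum-last (h ∘ (m G ↑ʳ_)))))

  incidenceSum-internal : ∀ h t → incidenceSum H h (n G ↑ʳ t) ≡ h (m G ↑ʳ inject₁ t) + h (m G ↑ʳ suc t)
  incidenceSum-internal h t = trans (incidenceSum-split h (n G ↑ʳ t)) (cong₂ _+_ (oldSum-↑ʳ t _)
    (trans (cong (λ z → pathSum z (h ∘ (m G ↑ʳ_))) (sym (pathVertex-middle t)))
           (pathSum-middle t (h ∘ (m G ↑ʳ_)))))

  module Labelled (f : Labeling G) (P : PathLabelling j) where

    open PathLabelling P

    newLabel : Fin (m G) ⊎ Fin (suc j) → ℕ
    newLabel (inj₁ e) = suc j + toℕ (Bijection.to f e)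
    newLabel (inj₂ i) = value (toℕ i)

    newLabel-< : ∀ s → newLabel s < m G + suc j
    newLabel-< (inj₁ e) = subst (newLabel (inj₁ e) <_) (+-comm (suc j) (m G)) (+-monoʳ-< (suc j) (toℕ<n _))
    newLabel-< (inj₂ i) = ≤-trans (s≤s (value-≤ (toℕ≤pred[n] i))) (m≤n+m (suc j) (m G))

    value<newLabel : ∀ i e → newLabel (inj₂ i) < newLabel (inj₁ e)
    value<newLabel i e = ≤-trans (s≤s (value-≤ (toℕ≤pred[n] i))) (m≤m+n (suc j) _)

    newLabel-injective : ∀ {s s′} → newLabel s ≡ newLabel s′ → s ≡ s′
    newLabel-injective {inj₁ e} {inj₁ e′} eq =
      cong inj₁ (Bijection.injective f (toℕ-injective (+-cancelˡ-≡ (suc j) _ _ eq)))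
    newLabel-injective {inj₁ e} {inj₂ i}  eq = contradiction (sym eq) (<⇒≢ (value<newLabel i e))
    newLabel-injective {inj₂ i} {inj₁ e}  eq = contradiction eq (<⇒≢ (value<newLabel i e))
    newLabel-injective {inj₂ i} {inj₂ i′} eq =
      cong inj₂ (toℕ-injective (value-injective (toℕ≤pred[n] i) (toℕ≤pred[n] i′) eq))

    relabel : Fin (m G + suc j) → Fin (m G + suc j)
    relabel z = fromℕ< (newLabel-< (splitAt (m G) z))

    toℕ-relabel : ∀ z → toℕ (relabel z) ≡ newLabel (splitAt (m G) z)
    toℕ-relabel z = toℕ-fromℕ< (newLabel-< (splitAt (m G) z))

    relabel-injective : Injective _≡_ _≡_ relabel
    relabel-injective {z} {z′} eq = begin
      z                              ≡⟨ join-splitAt (m G) (suc j) z ⟨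
      join _ _ (splitAt (m G) z)     ≡⟨ cong (join _ _) (newLabel-injective {splitAt _ z} {splitAt _ z′} same-newLabel) ⟩
      join _ _ (splitAt (m G) z′)    ≡⟨ join-splitAt (m G) (suc j) z′ ⟩
      z′                             ∎
      where
      open ≡-Reasoning
      same-newLabel : newLabel (splitAt (m G) z) ≡ newLabel (splitAt (m G) z′)
      same-newLabel = trans (sym (toℕ-relabel z)) (trans (cong toℕ eq) (toℕ-relabel z′))

    L : Labeling H
    L = mk⤖ (relabel-injective , injective⇒surjective relabel-injective)

    label-↑ˡ : ∀ e → label H L (e ↑ˡ suc j) ≡ suc j + label G f e
    label-↑ˡ e = begin
      suc (toℕ (relabel (e ↑ˡ suc j)))      ≡⟨ cong suc (toℕ-relabel (e ↑ˡ suc j)) ⟩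
      suc (newLabel (splitAt (m G) (e ↑ˡ suc j))) ≡⟨ cong (suc ∘ newLabel) (splitAt-↑ˡ (m G) e (suc j)) ⟩
      suc (suc j + toℕ (Bijection.to f e))  ≡⟨ +-suc (suc j) _ ⟨
      suc j + label G f e                   ∎
      where open ≡-Reasoning

    label-↑ʳ : ∀ i → label H L (m G ↑ʳ i) ≡ suc (value (toℕ i))
    label-↑ʳ i = trans (cong suc (toℕ-relabel (m G ↑ʳ i))) (cong (suc ∘ newLabel) (splitAt-↑ʳ (m G) (suc j) i))

    deg-old : ∀ {x} → x ≢ u → x ≢ v → deg H (x ↑ˡ j) ≡ deg G x
    deg-old {x} x≢u x≢v =
      trans (deg≡incidenceSum H (x ↑ˡ j)) (trans (incidenceSum-old _ x≢u x≢v) (sym (deg≡incidenceSum G x)))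

    deg-u : deg H (u ↑ˡ j) ≡ deg G u + 1
    deg-u = trans (deg≡incidenceSum H (u ↑ˡ j))
                  (trans (incidenceSum-u (λ _ → 1)) (cong (_+ 1) (sym (deg≡incidenceSum G u))))

    deg-v : deg H (v ↑ˡ j) ≡ deg G v + 1
    deg-v = trans (deg≡incidenceSum H (v ↑ˡ j))
                  (trans (incidenceSum-v (λ _ → 1)) (cong (_+ 1) (sym (deg≡incidenceSum G v))))

    deg-internal : ∀ t → deg H (n G ↑ʳ t) ≡ 2
    deg-internal t = trans (deg≡incidenceSum H (n G ↑ʳ t)) (incidenceSum-internal (λ _ → 1) t)

    oldEdgeSum : ∀ x → incidenceSum G (label H L ∘ (_↑ˡ suc j)) x ≡ φ G f x + suc j * deg G x
    oldEdgeSum x = begin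
      incidenceSum G (label H L ∘ (_↑ˡ suc j)) x
        ≡⟨ sum-cong-≗ (λ e → cong (indicator (incident? G x e)) (label-↑ˡ e)) ⟩
      incidenceSum G (λ e → suc j + label G f e) x
        ≡⟨ incidenceSum-shift G (label G f) (suc j) x ⟩
      incidenceSum G (label G f) x + suc j * incidenceSum G (λ _ → 1) x
        ≡⟨ cong₂ (λ a b → a + suc j * b) (φ≡incidenceSum G f x) (deg≡incidenceSum G x) ⟨
      φ G f x + suc j * deg G x
        ∎
      where open ≡-Reasoning

    φ-old : ∀ {x} → x ≢ u → x ≢ v → φ H L (x ↑ˡ j) ≡ φ G f x + suc j * deg G x
    φ-old {x} x≢u x≢v = trans (φ≡incidenceSum H L (x ↑ˡ j)) (trans (incidenceSum-old _ x≢u x≢v) (oldEdgeSum x))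

    φ-u : φ H L (u ↑ˡ j) ≡ φ G f u + suc j * deg G u + suc (value 0)
    φ-u = trans (φ≡incidenceSum H L (u ↑ˡ j))
                (trans (incidenceSum-u (label H L)) (cong₂ _+_ (oldEdgeSum u) (label-↑ʳ zero)))

    φ-v : φ H L (v ↑ˡ j) ≡ φ G f v + suc j * deg G v + suc (value j)
    φ-v = trans (φ≡incidenceSum H L (v ↑ˡ j)) (trans (incidenceSum-v (label H L)) (cong₂ _+_ (oldEdgeSum v)
            (trans (label-↑ʳ (fromℕ j)) (cong (suc ∘ value) (toℕ-fromℕ j)))))

    φ-internal : ∀ t → φ H L (n G ↑ʳ t) ≡ suc (value (toℕ t)) + suc (value (suc (toℕ t)))
    φ-internal t = trans (φ≡incidenceSum H L (n G ↑ʳ t)) (trans (incidenceSum-internal (label H L) t)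
      (cong₂ _+_ (trans (label-↑ʳ (inject₁ t)) (cong (suc ∘ value) (toℕ-inject₁ t))) (label-↑ʳ (suc t))))

-- The extended labelling is strongly antimagic

distinct-sum-< : ∀ {j a b} → a ≤ j → b ≤ j → a ≢ b → a + b < j + j
distinct-sum-< {a = a} {b} a≤j b≤j a≢b with <-cmp a b
... | tri< a<b _ _ = +-mono-<-≤ (<-≤-trans a<b b≤j) b≤j
... | tri≈ _ a≡b _ = contradiction a≡b a≢b
... | tri> _ _ b<a = +-mono-≤-< a≤j (<-≤-trans b<a a≤j)

module StrongExtension
  (G : Graph) {u v : Fin (n G)} (u≢v : u ≢ v) (u-leaf : Leaf G u) (v-leaf : Leaf G v)
  (only-leaves : ∀ x → Leaf G x → x ≡ u ⊎ x ≡ v)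
  (f : Labeling G) (f-antimagic : IsAntimagic G f) (f-strong : ∀ x y → deg G x > deg G y → φ G f x > φ G f y)
  (j : ℕ) (P : PathLabelling j)
  (oriented : (φ G f v < φ G f u × PathLabelling.value P 0 ≡ j)
            ⊎ (φ G f u < φ G f v × PathLabelling.value P j ≡ j))
  where

  open PathExtension G u≢v j
  open Labelled f P
  open PathLabelling P

  k : ℕ
  k = suc j

  data PathKind : Fin (n G + j) → Set where
    end-u    : PathKind (u ↑ˡ j)
    end-v    : PathKind (v ↑ˡ j)
    internal : ∀ t → PathKind (n G ↑ʳ t)

  data Kind : Fin (n G + j) → Set where
    old  : ∀ {x} → x ≢ u → x ≢ v → Kind (x ↑ˡ j)
    path : ∀ {z} → PathKind z → Kind z

  kind : ∀ z → Kind z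
  kind z = subst Kind (join-splitAt (n G) j z) (kind-join (splitAt (n G) z))
    where
    kind-join : ∀ s → Kind (join (n G) j s)
    kind-join (inj₂ t) = path (internal t)
    kind-join (inj₁ x) with x ≟ u | x ≟ v
    ... | yes refl | _        = path end-u
    ... | no _     | yes refl = path end-v
    ... | no x≢u   | no x≢v   = old x≢u x≢v

  pathWeight : ∀ {z} → PathKind z → ℕ
  pathWeight end-u         = φ G f u + k + suc (value 0)
  pathWeight end-v         = φ G f v + k + suc (value j)
  pathWeight (internal t) = suc (value (toℕ t)) + suc (value (suc (toℕ t)))

  degree : ∀ {z} → Kind z → ℕ
  degree (old {x} _ _) = deg G x
  degree (path _)      = 2

  weight : ∀ {z} → Kind z → ℕ
  weight (old {x} _ _) = φ G f x + k * deg G x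
  weight (path p)      = pathWeight p

  deg-kind : ∀ {z} (κ : Kind z) → deg H z ≡ degree κ
  deg-kind (old x≢u x≢v)       = deg-old x≢u x≢v
  deg-kind (path end-u)        = trans deg-u (cong (_+ 1) u-leaf)
  deg-kind (path end-v)        = trans deg-v (cong (_+ 1) v-leaf)
  deg-kind (path (internal t)) = deg-internal t

  k*leaf : ∀ {x} → Leaf G x → k * deg G x ≡ k
  k*leaf leaf = trans (cong (k *_) leaf) (*-identityʳ k)

  φ-kind : ∀ {z} (κ : Kind z) → φ H L z ≡ weight κ
  φ-kind (old x≢u x≢v)       = φ-old x≢u x≢v
  φ-kind (path end-u)        = trans φ-u (cong (λ c → φ G f u + c + suc (value 0)) (k*leaf u-leaf))
  φ-kind (path end-v)        = trans φ-v (cong (λ c → φ G f v + c + suc (value j)) (k*leaf v-leaf))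
  φ-kind (path (internal t)) = φ-internal t

  k+k≤k*d : ∀ {d} → 2 ≤ d → k + k ≤ k * d
  k+k≤k*d {d} 2≤d = begin
    k + k ≡⟨ cong (k +_) (+-identityʳ k) ⟨
    2 * k ≡⟨ *-comm 2 k ⟩
    k * 2 ≤⟨ *-monoʳ-≤ k 2≤d ⟩
    k * d ∎
    where open ≤-Reasoning

  pathWeight-positive : ∀ {z} (p : PathKind z) → 0 < pathWeight p
  pathWeight-positive end-u        = <-≤-trans z<s (m≤n+m (suc (value 0)) (φ G f u + k))
  pathWeight-positive end-v        = <-≤-trans z<s (m≤n+m (suc (value j)) (φ G f v + k))
  pathWeight-positive (internal t) = z<s

  internal<k+k : ∀ t → pathWeight (internal t) < k + k
  internal<k+k t = begin-strict
    suc a + suc b ≡⟨ cong suc (+-suc a b) ⟩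
    2 + (a + b)   <⟨ +-monoʳ-< 2 (distinct-sum-< (value-≤ (<⇒≤ t<j)) (value-≤ t<j) a≢b) ⟩
    2 + (j + j)   ≡⟨ solve (j ∷ []) ⟩
    suc j + suc j ∎
    where
    open ≤-Reasoning
    t<j = toℕ<n t
    a = value (toℕ t)
    b = value (suc (toℕ t))
    a≢b : a ≢ b
    a≢b eq = <-irrefl (value-injective (<⇒≤ t<j) t<j eq) (n<1+n (toℕ t))

  k+k≤end : ∀ {x r} → Leaf G x → j ≤ suc r → k + k ≤ φ G f x + k + suc r
  k+k≤end {x} {r} leaf j≤1+r = begin
    suc j + suc j       ≡⟨ solve (j ∷ []) ⟩
    1 + suc j + j       ≤⟨ +-mono-≤ (+-monoˡ-≤ k (subst (_≤ φ G f x) leaf (deg≤φ G f x))) j≤1+r ⟩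
    φ G f x + k + suc r ∎
    where open ≤-Reasoning

  end<old : ∀ {x y r} → Leaf G x → 2 ≤ deg G y → r ≤ j → φ G f x + k + suc r < φ G f y + k * deg G y
  end<old {x} {y} {r} leaf 2≤d r≤j = begin-strict
    φ G f x + k + suc r ≡⟨ +-assoc (φ G f x) k (suc r) ⟩
    φ G f x + (k + suc r) <⟨ +-mono-<-≤ (f-strong y x (subst (_< deg G y) (sym leaf) 2≤d))
                                         (+-monoʳ-≤ k (s≤s r≤j)) ⟩
    φ G f y + (k + k)     ≤⟨ +-monoʳ-≤ (φ G f y) (k+k≤k*d 2≤d) ⟩
    φ G f y + k * deg G y ∎
    where open ≤-Reasoning

  path<old : ∀ {z y} (p : PathKind z) → 2 ≤ deg G y → pathWeight p < φ G f y + k * deg G y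
  path<old end-u                   2≤d = end<old u-leaf 2≤d (value-≤ z≤n)
  path<old end-v                   2≤d = end<old v-leaf 2≤d (value-≤ ≤-refl)
  path<old {y = y} (internal t) 2≤d =
    <-≤-trans (internal<k+k t) (≤-trans (k+k≤k*d 2≤d) (m≤n+m _ (φ G f y)))

  internal<end-u : ∀ t → pathWeight (internal t) < pathWeight end-u
  internal<end-u t = <-≤-trans (internal<k+k t) (k+k≤end u-leaf first-≥)

  internal<end-v : ∀ t → pathWeight (internal t) < pathWeight end-v
  internal<end-v t = <-≤-trans (internal<k+k t) (k+k≤end v-leaf last-≥)

  end-u≢end-v : pathWeight end-u ≢ pathWeight end-v
  end-u≢end-v = Sum.[ lower-v , lower-u ]′ oriented
    where
    lower-v : φ G f v < φ G f u × value 0 ≡ j → pathWeight end-u ≢ pathWeight end-v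
    lower-v (φv<φu , value0≡j) =
      >⇒≢ (+-mono-<-≤ (+-monoˡ-< k φv<φu) (s≤s (subst (value j ≤_) (sym value0≡j) (value-≤ ≤-refl))))
    lower-u : φ G f u < φ G f v × value j ≡ j → pathWeight end-u ≢ pathWeight end-v
    lower-u (φu<φv , valuej≡j) =
      <⇒≢ (+-mono-<-≤ (+-monoˡ-< k φu<φv) (s≤s (subst (value 0 ≤_) (sym valuej≡j) (value-≤ z≤n))))

  internal-injective : ∀ {t t′} → pathWeight (internal t) ≡ pathWeight (internal t′) → t ≡ t′
  internal-injective {t} {t′} eq = toℕ-injective (adjacent-sum-injective (toℕ<n t) (toℕ<n t′)
    (suc-injective (trans (sym (+-suc _ _)) (trans (suc-injective eq) (+-suc _ _)))))

  isolated : ∀ {x} → x ≢ u → x ≢ v → deg G x < 2 → deg G x ≡ 0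
  isolated {x} x≢u x≢v d<2 with deg G x in eq
  ... | zero        = refl
  ... | suc zero    = ⊥-elim (Sum.[ x≢u , x≢v ]′ (only-leaves x eq))
  ... | suc (suc _) = ⊥-elim (<⇒≱ d<2 (s≤s (s≤s z≤n)))

  old-weight-isolated : ∀ {x} → x ≢ u → x ≢ v → deg G x < 2 → φ G f x + k * deg G x ≡ 0
  old-weight-isolated {x} x≢u x≢v d<2 rewrite isolated x≢u x≢v d<2 | φ-isolated G f x (isolated x≢u x≢v d<2) =
    *-zeroʳ k

  strong-kind : ∀ {z z′} (κ : Kind z) (κ′ : Kind z′) → degree κ′ < degree κ → weight κ′ < weight κ
  strong-kind (old {x} _ _) (old {y} _ _)   d = +-mono-<-≤ (f-strong x y d) (*-monoʳ-≤ k (<⇒≤ d))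
  strong-kind (old _ _)     (path p)        d = path<old p (<⇒≤ d)
  strong-kind (path p)      (old y≢u y≢v)   d rewrite old-weight-isolated y≢u y≢v d = pathWeight-positive p
  strong-kind (path _)      (path _)        (s≤s (s≤s ()))

  distinct-path : ∀ {z z′} (p : PathKind z) (q : PathKind z′) → z ≢ z′ → pathWeight p ≢ pathWeight q
  distinct-path end-u        end-u         z≢z′ = contradiction refl z≢z′
  distinct-path end-u        end-v         _    = end-u≢end-v
  distinct-path end-u        (internal t)  _    = >⇒≢ (internal<end-u t)
  distinct-path end-v        end-u         _    = end-u≢end-v ∘ sym
  distinct-path end-v        end-v         z≢z′ = contradiction refl z≢z′
  distinct-path end-v        (internal t)  _    = >⇒≢ (internal<end-v t)
  distinct-path (internal t) end-u         _    = <⇒≢ (internal<end-u t)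
  distinct-path (internal t) end-v         _    = <⇒≢ (internal<end-v t)
  distinct-path (internal t) (internal t′) z≢z′ = z≢z′ ∘ cong (n G ↑ʳ_) ∘ internal-injective

  distinct-kind : ∀ {z z′} (κ : Kind z) (κ′ : Kind z′) → z ≢ z′ →
                  degree κ ≡ degree κ′ → weight κ ≢ weight κ′
  distinct-kind (old {x} _ _) (old {y} _ _) z≢z′ d eq =
    f-antimagic x y (z≢z′ ∘ cong (_↑ˡ j))
      (+-cancelʳ-≡ _ _ _ (trans eq (cong (λ c → φ G f y + k * c) (sym d))))
  distinct-kind (old _ _) (path q) _    d = >⇒≢ (path<old q (≤-reflexive (sym d)))
  distinct-kind (path p)  (old _ _) _   d = <⇒≢ (path<old p (≤-reflexive d))
  distinct-kind (path p)  (path q) z≢z′ _ = distinct-path p q z≢z′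

  antimagic-kind : ∀ {z z′} (κ : Kind z) (κ′ : Kind z′) → z ≢ z′ → weight κ ≢ weight κ′
  antimagic-kind κ κ′ z≢z′ with <-cmp (degree κ) (degree κ′)
  ... | tri< d _ _ = <⇒≢ (strong-kind κ′ κ d)
  ... | tri≈ _ d _ = distinct-kind κ κ′ z≢z′ d
  ... | tri> _ _ d = >⇒≢ (strong-kind κ κ′ d)

  stronglyAntimagic : StronglyAntimagic H
  stronglyAntimagic = L , antimagic , strong
    where
    antimagic : IsAntimagic H L
    antimagic z z′ z≢z′ eq =
      antimagic-kind (kind z) (kind z′) z≢z′ (trans (sym (φ-kind (kind z))) (trans eq (φ-kind (kind z′))))
    strong : ∀ z z′ → deg H z > deg H z′ → φ H L z > φ H L z′
    strong z z′ d = subst₂ _<_ (sym (φ-kind (kind z′))) (sym (φ-kind (kind z)))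
      (strong-kind (kind z) (kind z′) (subst₂ _<_ (deg-kind (kind z′)) (deg-kind (kind z)) d))

corollary2p6 : (G : Graph) → Simple G → (u v : Fin (n G)) → ExactlyTwoLeaves G u v →
                 StronglyAntimagic G →
                 (k : ℕ) → 1 ≤ k → StronglyAntimagic (addPath G u v (k ∸ 1))
corollary2p6 G _ u v (u≢v , u-leaf , v-leaf , only-leaves) (f , f-antimagic , f-strong) (suc j) _ =
  oriented (φ G f v <? φ G f u)
  where
  open StrongExtension G u≢v u-leaf v-leaf only-leaves f f-antimagic f-strong j using (stronglyAntimagic)
  oriented : Dec (φ G f v < φ G f u) → StronglyAntimagic (addPath G u v j)
  oriented (yes φv<φu) = stronglyAntimagic (zigzagLabelling j) (inj₁ (φv<φu , refl))
  oriented (no  φv≮φu) = stronglyAntimagic (reverse (zigzagLabelling j))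
    (inj₂ (≤∧≢⇒< (≮⇒≥ φv≮φu) (f-antimagic u v u≢v) , cong (zigzag (suc j)) (n∸n≡0 j)))
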